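{- Let $G$ be a graph and let $C_1,\ldots,C_t$ be all the cycles of $G$, each oriented according to a given cycle orientation configuration. The configuration is geometric if and only if the only solution of $n_1C_1+n_2C_2+\cdots+n_tC_t=0$ (in $C_1(G,\mathbb{R})$) in nonnegative integers $n_1,\ldots,n_t$ is $n_1=\cdots=n_t=0$.
   Context: Graphs are finite and connected, possibly with parallel edges but without loops; cycles are simple. Each edge has a fixed reference orientation; an oriented cycle $C$ is identified with $\sum_{e\in C}\operatorname{sign}(C,e)e$ in the real vector space $C_1(G,\mathbb{R})$ with orthonormal basis $E(G)$, where $\operatorname{sign}(C,e)=\pm1$ according as $C$ traverses $e$ along or against its reference orientation. $H_1(G,\mathbb{R})$ is the span of all cycles. A cycle orientation configuration assigns an orientation to each cycle of $G$; it is geometric if there exists $\mathbf{w}\in H_1(G,\mathbb{R})$ with $\langle\mathbf{w},C\rangle>0$ for every cycle $C$ oriented as in the configuration.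
   Formalization: The vector $\mathbf{w}$ witnessing that a configuration is geometric is taken in the rational span of the cycles rather than in $H_1(G,\mathbb{R})$. -}

module Defs where

open import Data.Nat using (ℕ; zero; suc)
open import Data.Fin using (Fin; zero; suc; inject₁; fromℕ; _≟_)
open import Data.Bool using (Bool; true; false; if_then_else_)
open import Data.Product using (Σ; ∃; ∃-syntax; _×_; _,_; proj₁; proj₂)
open import Data.Integer as ℤ using (ℤ)
open import Data.Rational as ℚ using (ℚ; 0ℚ; _/_)
open import Relation.Binary.PropositionalEquality using (_≡_; _≢_)
open import Relation.Nullary using (yes; no)

sumℤ : ∀ {k} → (Fin k → ℤ) → ℤ
sumℤ {zero}  f = ℤ.0ℤ
sumℤ {suc k} f = f zero ℤ.+ sumℤ (λ i → f (suc i))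

sumℚ : ∀ {k} → (Fin k → ℚ) → ℚ
sumℚ {zero}  f = 0ℚ
sumℚ {suc k} f = f zero ℚ.+ sumℚ (λ i → f (suc i))

toℚ : ℤ → ℚ
toℚ z = z / 1

-- A finite loopless multigraph: vertices Fin n, edges Fin m, each edge e
-- with a reference orientation src e → tgt e.  Parallel edges allowed.

-- A dart is an edge together with a direction of traversal:
-- true = along the reference orientation, false = against it.
Dart : ℕ → Set
Dart m = Fin m × Bool

module _ {n m : ℕ} (src tgt : Fin m → Fin n) where
  tailD : Dart m → Fin n
  tailD (e , true)  = src e
  tailD (e , false) = tgt e

  headD : Dart m → Fin n
  headD (e , true)  = tgt e
  headD (e , false) = src e

  data Walk : Fin n → Fin n → Set where
    [] : ∀ {u} → Walk u u
    _∷_ : ∀ {v} (d : Dart m) → Walk (headD d) v → Walk (tailD d) v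

record Graph : Set where
  field
    n m       : ℕ
    src tgt   : Fin m → Fin n
    loopless  : ∀ e → src e ≢ tgt e
    nonempty  : Fin n
    connected : ∀ u v → Walk src tgt u v

module _ (G : Graph) where
  open Graph G

  tl hd : Dart m → Fin n
  tl = tailD src tgt
  hd = headD src tgt

  record OrientedCycle : Set where
    field
      len    : ℕ
      darts  : Fin (suc len) → Dart m
      step   : ∀ (i : Fin len) → hd (darts (inject₁ i)) ≡ tl (darts (suc i))
      close  : hd (darts (fromℕ len)) ≡ tl (darts zero)
      vertInj : ∀ i j → tl (darts i) ≡ tl (darts j) → i ≡ j
      edgeInj : ∀ i j → proj₁ (darts i) ≡ proj₁ (darts j) → i ≡ j

  sign : Bool → ℤ
  sign true  = ℤ.1ℤ
  sign false = ℤ.-1ℤ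

  -- The oriented cycle as the vector Σ sign(C,e) e ∈ C₁(G) (coordinates).
  vec : OrientedCycle → Fin m → ℤ
  vec C e = sumℤ (λ i → contrib (darts i))
    where
      open OrientedCycle C
      contrib : Dart m → ℤ
      contrib (e′ , b) with e′ ≟ e
      ... | yes _ = sign b
      ... | no  _ = ℤ.0ℤ

  inner : (Fin m → ℚ) → OrientedCycle → ℚ
  inner w C = sumℚ (λ e → w e ℚ.* toℚ (vec C e))

  -- A cycle orientation configuration: it selects, for every cycle,
  -- exactly one of its two orientations.  We record it as the predicate
  -- "this oriented cycle carries the orientation chosen by the
  -- configuration"; two oriented cycles with the same vector are the same
  -- oriented cycle, and two with opposite vectors are the two
  -- orientations of the same cycle.
  record Configuration : Set where
    field
      chosen   : OrientedCycle → Bool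
      sameVec  : ∀ C D → (∀ e → vec C e ≡ vec D e) → chosen C ≡ chosen D
      oppVec   : ∀ C D → (∀ e → vec C e ≡ ℤ.- vec D e) → chosen C ≢ chosen D

  open Configuration

  InH₁ : (Fin m → ℚ) → Set
  InH₁ w = Σ ℕ λ k → Σ (Fin k → OrientedCycle) λ D → Σ (Fin k → ℚ) λ q →
             ∀ e → w e ≡ sumℚ (λ j → q j ℚ.* toℚ (vec (D j) e))

  Geometric : Configuration → Set
  Geometric κ = Σ (Fin m → ℚ) λ w → InH₁ w ×
                  (∀ C → chosen κ C ≡ true → 0ℚ ℚ.< inner w C)

  -- The only nonnegative integer solution of Σ nᵢ Cᵢ = 0 over the
  -- configured cycles is the trivial one.  (A finite family of configured
  -- cycles; repetitions are harmless.)
  OnlyTrivialSolution : Configuration → Set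
  OnlyTrivialSolution κ =
    ∀ (k : ℕ) (C : Fin k → OrientedCycle) →
    (∀ i → chosen κ (C i) ≡ true) →
    (nn : Fin k → ℕ) →
    (∀ e → sumℤ (λ i → ℤ.+ (nn i) ℤ.* vec (C i) e) ≡ ℤ.0ℤ) →
    ∀ i → nn i ≡ 0

{-# OPTIONS --safe #-}
module Submission where

-- Let a₁,…,a_t ∈ ℤ^E be the vectors of the chosen oriented cycles; there are finitely many,
-- because a cycle is a sequence of at most |E| darts with distinct edges. Gordan's alternative
-- says that either ⟨aᵢ,x⟩ > 0 for all i for some x, or a nontrivial nonnegative integer
-- combination of the aᵢ vanishes; pairing such a combination with x shows that not both hold,
-- which is the forward direction. Gordan is proved by induction on t: with b = a₁, solve for
-- a₂,…,a_t and for their components (b·b)aᵢ − (aᵢ·b)b orthogonal to b. A solution x′ of the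
-- latter, made orthogonal to b, scaled up and shifted by b, solves the whole system; a dependency
-- among the components is either a dependency of the aᵢ involving b, or it shows that the
-- solution x of a₂,…,a_t already has ⟨b,x⟩ > 0. Applied to the Gram matrix (⟨aᵢ,aⱼ⟩), Gordan
-- yields x in the span of the aᵢ, hence in H₁, while a dependency v = Σ yᵢaᵢ of the Gram rows has
-- ⟨v,v⟩ = 0, so v = 0.

open import Algebra.Bundles using (CommutativeRing)
import Algebra.Properties.CommutativeSemigroup as CommSemigroupProperties
import Algebra.Properties.Semiring.Sum as SemiringSum
open import Data.Bool as Bool using (Bool; true; false)
open import Data.Empty using (⊥-elim)
open import Data.Fin using (Fin; zero; suc; inject₁; fromℕ; _≟_)
import Data.Fin.Properties as FinP
open import Data.Integer as ℤ using (ℤ; +_; -[1+_]; 0ℤ; 1ℤ; _+_; _*_; -_; _-_; ∣_∣; _≤_; _<_; +≤+; +<+)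
import Data.Integer.Properties as ℤP
open import Data.Integer.Tactic.RingSolver using (solve-∀)
open import Data.List as List using (List; []; _∷_; [_]; length; filter; cartesianProduct; cartesianProductWith; concatMap; mapMaybe; upTo; allFin)
open import Data.List.Membership.Propositional using (_∈_)
open import Data.List.Membership.Propositional.Properties using (∈-cartesianProduct⁺; ∈-allFin; ∈-upTo⁺; ∈-lookup)
import Data.List.Relation.Unary.All as All
import Data.List.Relation.Unary.All.Properties as AllP
open import Data.List.Relation.Unary.Any as Any using (Any; here; there)
import Data.List.Relation.Unary.Any.Properties as AnyP
open import Data.Maybe using (Maybe; just; nothing)
import Data.Maybe.Relation.Unary.Any as MAny
open import Data.Nat as ℕ using (ℕ; zero; suc; z≤n; s≤s)
import Data.Nat.Properties as ℕP
open import Data.Product using (Σ-syntax; ∃; ∃-syntax; _×_; _,_; proj₁; proj₂; uncurry)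
open import Data.Rational as ℚ using (ℚ; 0ℚ)
import Data.Rational.Properties as ℚP
open import Data.Rational.Unnormalised as ℚᵘ using (mkℚᵘ; *≡*) renaming (_≃_ to _≃ᵘ_)
import Data.Rational.Unnormalised.Properties as ℚᵘP
open import Data.Sum using (_⊎_; inj₁; inj₂; [_,_]′; reduce)
open import Data.Vec.Functional as Vec using (Vector; tail)
open import Function using (_∘_)
open import Function.Bundles using (_⇔_; mk⇔)
open import Relation.Binary.PropositionalEquality using (_≡_; _≢_; _≗_; refl; sym; trans; cong; cong₂; subst; subst₂; module ≡-Reasoning)
open import Relation.Nullary using (¬_; Dec; yes; no; _×-dec_; _→-dec_; contradiction)

open import Defs

-- Gordan's alternative over ℤ

module ℤ* = CommSemigroupProperties ℤP.*-commutativeSemigroup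
module ℤΣ = SemiringSum ℤP.+-*-semiring
open ℤΣ using (sum; sum-syntax; sum-cong-≗)

sum-nonneg : ∀ {k} (f : Vector ℤ k) → (∀ i → 0ℤ ≤ f i) → 0ℤ ≤ sum f
sum-nonneg {zero}  f f≥0 = ℤP.≤-refl
sum-nonneg {suc k} f f≥0 = ℤP.+-mono-≤ (f≥0 zero) (sum-nonneg (f ∘ suc) (f≥0 ∘ suc))

term≤sum : ∀ {k} (f : Vector ℤ k) → (∀ i → 0ℤ ≤ f i) → ∀ j → f j ≤ sum f
term≤sum f f≥0 zero    = ℤP.i≤i+j (f zero) _ {{ℤ.nonNegative (sum-nonneg (f ∘ suc) (f≥0 ∘ suc))}}
term≤sum f f≥0 (suc j) = ℤP.i≤j⇒i≤k+j (f zero) {{ℤ.nonNegative (f≥0 zero)}} (term≤sum (f ∘ suc) (f≥0 ∘ suc) j)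

square-nonneg : ∀ z → 0ℤ ≤ z * z
square-nonneg (+ zero)   = +≤+ z≤n
square-nonneg ℤ.+[1+ n ] = +≤+ z≤n
square-nonneg -[1+ n ]   = +≤+ z≤n

sum-zero : ∀ {k} (f : Vector ℤ k) → (∀ i → f i ≡ 0ℤ) → sum f ≡ 0ℤ
sum-zero {k} f f≗0 = trans (sum-cong-≗ f≗0) (ℤΣ.sum-replicate-zero k)

pos*pos⇒pos : ∀ {p q} → 0ℤ < p → 0ℤ < q → 0ℤ < p * q
pos*pos⇒pos {p} 0<p 0<q = subst (_< p * _) (ℤP.*-zeroʳ p) (ℤP.*-monoˡ-<-pos p {{ℤ.positive 0<p}} 0<q)

nonNeg*nonNeg⇒nonNeg : ∀ {p q} → 0ℤ ≤ p → 0ℤ ≤ q → 0ℤ ≤ p * q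
nonNeg*nonNeg⇒nonNeg {p} 0≤p 0≤q = subst (_≤ p * _) (ℤP.*-zeroʳ p) (ℤP.*-monoˡ-≤-nonNeg p {{ℤ.nonNegative 0≤p}} 0≤q)

infixl 6 _+ᵥ_
infixl 7 _*ᵥ_ _·_

_+ᵥ_ : ∀ {m} → Vector ℤ m → Vector ℤ m → Vector ℤ m
(u +ᵥ v) e = u e + v e

_*ᵥ_ : ∀ {m} → ℤ → Vector ℤ m → Vector ℤ m
(α *ᵥ v) e = α * v e

_·_ : ∀ {m} → Vector ℤ m → Vector ℤ m → ℤ
_·_ {m} u v = ∑[ e < m ] (u e * v e)

combination : ∀ {t m} → Vector ℤ t → Vector (Vector ℤ m) t → Vector ℤ m
combination {t} c a e = ∑[ i < t ] (c i * a i e)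

module _ {m : ℕ} where

  ·-comm : (u v : Vector ℤ m) → u · v ≡ v · u
  ·-comm u v = sum-cong-≗ (λ e → ℤP.*-comm (u e) (v e))

  ·-distribˡ-+ᵥ : (u v w : Vector ℤ m) → u · (v +ᵥ w) ≡ u · v + u · w
  ·-distribˡ-+ᵥ u v w = trans (sum-cong-≗ (λ e → ℤP.*-distribˡ-+ (u e) (v e) (w e)))
                              (ℤΣ.∑-distrib-+ (λ e → u e * v e) (λ e → u e * w e))

  ·-*ᵥ : (u : Vector ℤ m) (α : ℤ) (v : Vector ℤ m) → u · (α *ᵥ v) ≡ α * (u · v)
  ·-*ᵥ u α v = trans (sum-cong-≗ (λ e → ℤ*.x∙yz≈y∙xz (u e) α (v e)))
                     (sym (ℤΣ.*-distribˡ-sum α (λ e → u e * v e)))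

  ·-self-nonneg : (v : Vector ℤ m) → 0ℤ ≤ v · v
  ·-self-nonneg v = sum-nonneg _ (square-nonneg ∘ v)

  ·-self≡0⇒≗0 : (v : Vector ℤ m) → v · v ≡ 0ℤ → ∀ e → v e ≡ 0ℤ
  ·-self≡0⇒≗0 v v·v≡0 e = reduce (ℤP.i*j≡0⇒i≡0∨j≡0 (v e) square≡0)
    where
    square≡0 : v e * v e ≡ 0ℤ
    square≡0 = ℤP.≤-antisym (subst (v e * v e ≤_) v·v≡0 (term≤sum _ (square-nonneg ∘ v) e)) (square-nonneg (v e))

  combination-· : ∀ {t} (c : Vector ℤ t) (a : Vector (Vector ℤ m) t) (x : Vector ℤ m) →
                  combination c a · x ≡ ∑[ i < t ] (c i * (a i · x))
  combination-· {t} c a x = begin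
    ∑[ e < m ] (∑[ i < t ] (c i * a i e) * x e)
      ≡⟨ sum-cong-≗ (λ e → ℤΣ.*-distribʳ-sum (x e) (λ i → c i * a i e)) ⟩
    ∑[ e < m ] ∑[ i < t ] (c i * a i e * x e)
      ≡⟨ ℤΣ.∑-comm (λ e i → c i * a i e * x e) ⟩
    ∑[ i < t ] ∑[ e < m ] (c i * a i e * x e)
      ≡⟨ sum-cong-≗ (λ i → sum-cong-≗ (λ e → ℤP.*-assoc (c i) (a i e) (x e))) ⟩
    ∑[ i < t ] ∑[ e < m ] (c i * (a i e * x e))
      ≡⟨ sum-cong-≗ (λ i → sym (ℤΣ.*-distribˡ-sum (c i) (λ e → a i e * x e))) ⟩
    ∑[ i < t ] (c i * (a i · x))                 ∎
    where open ≡-Reasoning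

  -- (b·b) v − (v·b) b: the component of v orthogonal to b, scaled by b·b to stay integral.
  reject : Vector ℤ m → Vector ℤ m → Vector ℤ m
  reject b v = (b · b) *ᵥ v +ᵥ (- (v · b)) *ᵥ b

  ·-reject : (u b v : Vector ℤ m) → u · reject b v ≡ (b · b) * (u · v) + - (v · b) * (u · b)
  ·-reject u b v = trans (·-distribˡ-+ᵥ u _ _) (cong₂ _+_ (·-*ᵥ u (b · b) v) (·-*ᵥ u (- (v · b)) b))

  reject-orthogonal : (b v : Vector ℤ m) → b · reject b v ≡ 0ℤ
  reject-orthogonal b v = begin
    b · reject b v                          ≡⟨ ·-reject b b v ⟩
    (b · b) * (b · v) + - (v · b) * (b · b) ≡⟨ cong (λ z → (b · b) * z + - (v · b) * (b · b)) (·-comm b v) ⟩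
    (b · b) * (v · b) + - (v · b) * (b · b) ≡⟨ cancel (b · b) (v · b) ⟩
    0ℤ                                      ∎
    where
    open ≡-Reasoning
    cancel : ∀ x y → x * y + - y * x ≡ 0ℤ
    cancel = solve-∀

  reject-selfAdjoint : (u b v : Vector ℤ m) → u · reject b v ≡ reject b u · v
  reject-selfAdjoint u b v = begin
    u · reject b v                          ≡⟨ ·-reject u b v ⟩
    (b · b) * (u · v) + - (v · b) * (u · b) ≡⟨ cong (λ z → (b · b) * z + - (v · b) * (u · b)) (·-comm u v) ⟩
    (b · b) * (v · u) + - (v · b) * (u · b) ≡⟨ swap (b · b) (v · u) (v · b) (u · b) ⟩
    (b · b) * (v · u) + - (u · b) * (v · b) ≡⟨ ·-reject v b u ⟨
    v · reject b u                          ≡⟨ ·-comm v (reject b u) ⟩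
    reject b u · v                          ∎
    where
    open ≡-Reasoning
    swap : ∀ n p q r → n * p + - q * r ≡ n * p + - r * q
    swap = solve-∀

  reject-combination : ∀ {t} (b : Vector ℤ m) (c : Vector ℤ t) (a : Vector (Vector ℤ m) t) →
                       ∀ e → combination c (reject b ∘ a) e ≡ reject b (combination c a) e
  reject-combination {t} b c a e = begin
    ∑[ i < t ] (c i * ((b · b) * a i e + - (a i · b) * b e))
      ≡⟨ sum-cong-≗ (λ i → expand (c i) (b · b) (a i e) (a i · b) (b e)) ⟩
    ∑[ i < t ] ((b · b) * (c i * a i e) + c i * (a i · b) * - b e)
      ≡⟨ ℤΣ.∑-distrib-+ (λ i → (b · b) * (c i * a i e)) (λ i → c i * (a i · b) * - b e) ⟩
    ∑[ i < t ] ((b · b) * (c i * a i e)) + ∑[ i < t ] (c i * (a i · b) * - b e)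
      ≡⟨ cong₂ _+_ (ℤΣ.*-distribˡ-sum (b · b) (λ i → c i * a i e))
                   (ℤΣ.*-distribʳ-sum (- b e) (λ i → c i * (a i · b))) ⟨
    (b · b) * combination c a e + ∑[ i < t ] (c i * (a i · b)) * - b e
      ≡⟨ cong (λ z → (b · b) * combination c a e + z * - b e) (combination-· c a b) ⟨
    (b · b) * combination c a e + (combination c a · b) * - b e
      ≡⟨ cong (λ z → (b · b) * combination c a e + z) (negate-left (combination c a · b) (b e)) ⟩
    reject b (combination c a) e ∎
    where
    open ≡-Reasoning
    expand : ∀ x n y p z → x * (n * y + - p * z) ≡ n * (x * y) + x * p * - z
    expand = solve-∀
    negate-left : ∀ x y → x * - y ≡ - x * y
    negate-left = solve-∀

Separates : ∀ {t m} → Vector (Vector ℤ m) t → Vector ℤ m → Set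
Separates a x = ∀ i → 0ℤ < a i · x

NonnegDependency : ∀ {t m} → Vector (Vector ℤ m) t → Set
NonnegDependency {t} a = Σ[ y ∈ Vector ℕ t ] (∃[ i ] y i ≢ 0) × (∀ e → combination (+_ ∘ y) a e ≡ 0ℤ)

combination-·-pos : ∀ {t m} {a : Vector (Vector ℤ m) t} {x} → Separates a x →
                    (y : Vector ℕ t) → ∀ {i} → y i ≢ 0 → 0ℤ < combination (+_ ∘ y) a · x
combination-·-pos {a = a} {x} sep y {i} yi≢0 = subst (0ℤ <_) (sym (combination-· (+_ ∘ y) a x)) (begin-strict
  0ℤ                              <⟨ pos*pos⇒pos {+ y i} (ℤ.+<+ (ℕP.n≢0⇒n>0 yi≢0)) (sep i) ⟩
  + y i * (a i · x)               ≤⟨ term≤sum _ (λ j → nonNeg*nonNeg⇒nonNeg {+ y j} (+≤+ z≤n) (ℤP.<⇒≤ (sep j))) i ⟩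
  sum (λ j → + y j * (a j · x))   ∎)
  where open ℤP.≤-Reasoning

multiple-dominates : ∀ {k p} d → 0ℤ < p → 1ℤ + + ∣ d ∣ ≤ k → 0ℤ < k * p + d
multiple-dominates {k} {p} d 0<p 1+∣d∣≤k = begin-strict
  0ℤ                  <⟨ 0<1+∣d∣+d d ⟩
  1ℤ + + ∣ d ∣ + d    ≤⟨ ℤP.+-monoˡ-≤ d (ℤP.≤-trans 1+∣d∣≤k k≤k*p) ⟩
  k * p + d           ∎
  where
  open ℤP.≤-Reasoning
  cancel : ∀ x → 1ℤ + x + - x ≡ 1ℤ
  cancel = solve-∀
  0<1+∣d∣+d : ∀ d → 0ℤ < 1ℤ + + ∣ d ∣ + d
  0<1+∣d∣+d (+ n)    = +<+ (s≤s z≤n)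
  0<1+∣d∣+d -[1+ n ] = subst (0ℤ <_) (sym (cancel (+ suc n))) (+<+ (s≤s z≤n))
  k≤k*p : k ≤ k * p
  k≤k*p = subst (_≤ k * p) (ℤP.*-identityʳ k)
                (ℤP.*-monoˡ-≤-nonNeg k {{ℤ.nonNegative (ℤP.≤-trans (+≤+ z≤n) 1+∣d∣≤k)}} (ℤP.i<j⇒suc[i]≤j 0<p))

module _ {t m : ℕ} (a : Vector (Vector ℤ m) (suc t)) where

  private
    b : Vector ℤ m
    b = a zero

  dependency-of-head≡0 : b · b ≡ 0ℤ → NonnegDependency a
  dependency-of-head≡0 b·b≡0 = y , (zero , λ ()) , λ e →
    cong₂ _+_ (trans (ℤP.*-identityˡ (b e)) (·-self≡0⇒≗0 b b·b≡0 e)) (sum-zero _ (λ i → ℤP.*-zeroˡ (a (suc i) e)))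
    where
    y : Vector ℕ (suc t)
    y zero    = 1
    y (suc _) = 0

  dependency-of-tail : NonnegDependency (tail a) → NonnegDependency a
  dependency-of-tail (y , (i , yi≢0) , dep) = (0 Vec.∷ y) , (suc i , yi≢0) , λ e → trans (ℤP.+-identityˡ _) (dep e)

  module _ (b·b≢0 : b · b ≢ 0ℤ) where

    private
      0<b·b : 0ℤ < b · b
      0<b·b = ℤP.≤∧≢⇒< (·-self-nonneg b) (b·b≢0 ∘ sym)

    separable-of-rejected : ∃ (Separates (reject b ∘ tail a)) → ∃ (Separates a)
    separable-of-rejected (x , sep) = X , λ where
        zero    → subst (0ℤ <_) (sym b·X) 0<b·b
        (suc i) → subst (0ℤ <_) (sym (·X (a (suc i))))
                    (multiple-dominates (a (suc i) · b)
                      (subst (0ℤ <_) (sym (reject-selfAdjoint (a (suc i)) b x)) (sep i))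
                      (ℤP.+-monoʳ-≤ 1ℤ (term≤sum (λ j → + ∣ a (suc j) · b ∣) (λ _ → +≤+ z≤n) i)))
      where
      K : ℤ
      K = 1ℤ + ∑[ j < t ] (+ ∣ a (suc j) · b ∣)
      X : Vector ℤ m
      X = K *ᵥ reject b x +ᵥ b
      ·X : ∀ u → u · X ≡ K * (u · reject b x) + u · b
      ·X u = trans (·-distribˡ-+ᵥ u _ b) (cong (_+ u · b) (·-*ᵥ u K (reject b x)))
      b·X : b · X ≡ b · b
      b·X = begin
        b · X                         ≡⟨ ·X b ⟩
        K * (b · reject b x) + b · b  ≡⟨ cong (λ z → K * z + b · b) (reject-orthogonal b x) ⟩
        K * 0ℤ + b · b                ≡⟨ cong (_+ b · b) (ℤP.*-zeroʳ K) ⟩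
        0ℤ + b · b                    ≡⟨ ℤP.+-identityˡ (b · b) ⟩
        b · b                         ∎
        where open ≡-Reasoning

    module _ (y : Vector ℕ t) (dep : ∀ e → combination (+_ ∘ y) (reject b ∘ tail a) e ≡ 0ℤ) where

      private
        v : Vector ℤ m
        v = combination (+_ ∘ y) (tail a)

        v-rejected≗0 : ∀ e → reject b v e ≡ 0ℤ
        v-rejected≗0 e = trans (sym (reject-combination b (+_ ∘ y) (tail a) e)) (dep e)

      dependency-if-v·b≤0 : v · b ≤ 0ℤ → ∀ {i} → y i ≢ 0 → NonnegDependency a
      dependency-if-v·b≤0 v·b≤0 {i} yi≢0 = Y , (suc i , Yi≢0) , λ e → trans (Y-combination e) (v-rejected≗0 e)
        where
        Y : Vector ℕ (suc t)
        Y = ∣ v · b ∣ Vec.∷ λ j → ∣ b · b ∣ ℕ.* y j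
        Yi≢0 : ∣ b · b ∣ ℕ.* y i ≢ 0
        Yi≢0 eq = [ b·b≢0 ∘ ℤP.∣i∣≡0⇒i≡0 , yi≢0 ]′ (ℕP.m*n≡0⇒m≡0∨n≡0 ∣ b · b ∣ eq)
        +∣v·b∣≡-v·b : + ∣ v · b ∣ ≡ - (v · b)
        +∣v·b∣≡-v·b = trans (cong +_ (sym (ℤP.∣-i∣≡∣i∣ (v · b)))) (ℤP.0≤i⇒+∣i∣≡i (ℤP.neg-mono-≤ v·b≤0))
        +∣b·b∣≡b·b : + ∣ b · b ∣ ≡ b · b
        +∣b·b∣≡b·b = ℤP.0≤i⇒+∣i∣≡i (·-self-nonneg b)
        scaled : ∀ e j → + (∣ b · b ∣ ℕ.* y j) * a (suc j) e ≡ (b · b) * (+ y j * a (suc j) e)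
        scaled e j = trans (cong (_* a (suc j) e) (trans (ℤP.pos-* ∣ b · b ∣ (y j)) (cong (_* + y j) +∣b·b∣≡b·b)))
                           (ℤP.*-assoc (b · b) (+ y j) (a (suc j) e))
        Y-combination : ∀ e → combination (+_ ∘ Y) a e ≡ reject b v e
        Y-combination e = begin
          + ∣ v · b ∣ * b e + ∑[ j < t ] (+ (∣ b · b ∣ ℕ.* y j) * a (suc j) e)
            ≡⟨ cong₂ (λ p q → p * b e + q) +∣v·b∣≡-v·b (sum-cong-≗ (scaled e)) ⟩
          - (v · b) * b e + ∑[ j < t ] ((b · b) * (+ y j * a (suc j) e))
            ≡⟨ cong (λ z → - (v · b) * b e + z) (ℤΣ.*-distribˡ-sum (b · b) (λ j → + y j * a (suc j) e)) ⟨
          - (v · b) * b e + (b · b) * v e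
            ≡⟨ ℤP.+-comm (- (v · b) * b e) ((b · b) * v e) ⟩
          reject b v e ∎
          where open ≡-Reasoning

      head-separated-if-0<v·b : 0ℤ < v · b → ∀ {i} → y i ≢ 0 → ∀ {x} → Separates (tail a) x → 0ℤ < b · x
      head-separated-if-0<v·b 0<v·b yi≢0 {x} sep =
        subst (0ℤ <_) (·-comm x b) (ℤP.*-cancelˡ-<-nonNeg (v · b) {{ℤ.nonNegative (ℤP.<⇒≤ 0<v·b)}} (begin-strict
          (v · b) * 0ℤ        ≡⟨ ℤP.*-zeroʳ (v · b) ⟩
          0ℤ                  <⟨ pos*pos⇒pos 0<b·b 0<x·v ⟩
          (b · b) * (x · v)   ≡⟨ ℤP.i-j≡0⇒i≡j _ _ x·rejected≡0 ⟩
          (v · b) * (x · b)   ∎))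
        where
        open ℤP.≤-Reasoning
        0<x·v : 0ℤ < x · v
        0<x·v = subst (0ℤ <_) (·-comm v x) (combination-·-pos {a = tail a} {x} sep y yi≢0)
        x·rejected≡0 : (b · b) * (x · v) - (v · b) * (x · b) ≡ 0ℤ
        x·rejected≡0 = begin-equality
          (b · b) * (x · v) - (v · b) * (x · b)
            ≡⟨ cong (λ z → (b · b) * (x · v) + z) (ℤP.neg-distribˡ-* (v · b) (x · b)) ⟩
          (b · b) * (x · v) + - (v · b) * (x · b)
            ≡⟨ ·-reject x b v ⟨
          x · reject b v
            ≡⟨ sum-zero _ (λ e → trans (cong (x e *_) (v-rejected≗0 e)) (ℤP.*-zeroʳ (x e))) ⟩
          0ℤ ∎

      separable-or-dependent : ∀ {i} → y i ≢ 0 → ∃ (Separates (tail a)) → ∃ (Separates a) ⊎ NonnegDependency a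
      separable-or-dependent yi≢0 (x , sep) with v · b ℤ.≤? 0ℤ
      ... | yes v·b≤0 = inj₂ (dependency-if-v·b≤0 v·b≤0 yi≢0)
      ... | no  v·b≰0 = inj₁ (x , λ where
                                   zero    → head-separated-if-0<v·b (ℤP.≰⇒> v·b≰0) yi≢0 sep
                                   (suc j) → sep j)

gordan : ∀ {t m} (a : Vector (Vector ℤ m) t) → ∃ (Separates a) ⊎ NonnegDependency a
gordan {zero}  a = inj₁ ((λ _ → 0ℤ) , λ ())
gordan {suc t} a with a zero · a zero ℤ.≟ 0ℤ
... | yes b·b≡0 = inj₂ (dependency-of-head≡0 a b·b≡0)
... | no  b·b≢0 with gordan (tail a) | gordan (reject (a zero) ∘ tail a)
...   | inj₂ dep      | _                        = inj₂ (dependency-of-tail a dep)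
...   | inj₁ _        | inj₁ sep′                = inj₁ (separable-of-rejected a b·b≢0 sep′)
...   | inj₁ sep      | inj₂ (y , (_ , yi≢0) , dep′) = separable-or-dependent a b·b≢0 y dep′ yi≢0 sep

gram : ∀ {t m} → Vector (Vector ℤ m) t → Vector (Vector ℤ t) t
gram a i j = a i · a j

gordan-span : ∀ {t m} (a : Vector (Vector ℤ m) t) →
              (∃ λ c → Separates a (combination c a)) ⊎ NonnegDependency a
gordan-span {t} a with gordan (gram a)
... | inj₁ (c , sep) = inj₁ (c , λ i → subst (0ℤ <_) (gram-· i) (sep i))
  where
  gram-· : ∀ i → gram a i · c ≡ a i · combination c a
  gram-· i = begin
    ∑[ j < t ] ((a i · a j) * c j)
      ≡⟨ sum-cong-≗ (λ j → trans (ℤP.*-comm (a i · a j) (c j)) (cong (c j *_) (·-comm (a i) (a j)))) ⟩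
    ∑[ j < t ] (c j * (a j · a i))
      ≡⟨ combination-· c a (a i) ⟨
    combination c a · a i
      ≡⟨ ·-comm (combination c a) (a i) ⟩
    a i · combination c a ∎
    where open ≡-Reasoning
... | inj₂ (y , y≢0 , dep) = inj₂ (y , y≢0 , ·-self≡0⇒≗0 v v·v≡0)
  where
  v : Vector ℤ _
  v = combination (+_ ∘ y) a
  v⊥a : ∀ j → v · a j ≡ 0ℤ
  v⊥a j = trans (combination-· (+_ ∘ y) a (a j)) (dep j)
  v·v≡0 : v · v ≡ 0ℤ
  v·v≡0 = begin
    v · v                           ≡⟨ combination-· (+_ ∘ y) a v ⟩
    ∑[ j < t ] (+ y j * (a j · v))  ≡⟨ sum-zero _ (λ j → trans (cong (+ y j *_) (trans (·-comm (a j) v) (v⊥a j)))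
                                                               (ℤP.*-zeroʳ (+ y j))) ⟩
    0ℤ                              ∎
    where open ≡-Reasoning


-- Rational pairings

module ℚΣ = SemiringSum (CommutativeRing.semiring ℚP.+-*-commutativeRing)
module ℚ* = CommSemigroupProperties (CommutativeRing.*-commutativeSemigroup ℚP.+-*-commutativeRing)

toℚᵘ-toℚ : ∀ z → ℚ.toℚᵘ (toℚ z) ≃ᵘ mkℚᵘ z 0
toℚᵘ-toℚ z = ℚP.toℚᵘ-fromℚᵘ (mkℚᵘ z 0)

toℚ-+ : ∀ p q → toℚ (p + q) ≡ toℚ p ℚ.+ toℚ q
toℚ-+ p q = ℚP.toℚᵘ-injective (begin
  ℚ.toℚᵘ (toℚ (p + q))                    ≈⟨ toℚᵘ-toℚ (p + q) ⟩
  mkℚᵘ (p + q) 0                          ≈⟨ *≡* (denominators-one p q) ⟩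
  mkℚᵘ p 0 ℚᵘ.+ mkℚᵘ q 0                  ≈⟨ ℚᵘP.+-cong (toℚᵘ-toℚ p) (toℚᵘ-toℚ q) ⟨
  ℚ.toℚᵘ (toℚ p) ℚᵘ.+ ℚ.toℚᵘ (toℚ q)      ≈⟨ ℚP.toℚᵘ-homo-+ (toℚ p) (toℚ q) ⟨
  ℚ.toℚᵘ (toℚ p ℚ.+ toℚ q)                ∎)
  where
  open ℚᵘP.≃-Reasoning
  denominators-one : ∀ p q → (p + q) * (1ℤ * 1ℤ) ≡ (p * 1ℤ + q * 1ℤ) * 1ℤ
  denominators-one = solve-∀

toℚ-* : ∀ p q → toℚ (p * q) ≡ toℚ p ℚ.* toℚ q
toℚ-* p q = ℚP.toℚᵘ-injective (begin
  ℚ.toℚᵘ (toℚ (p * q))                    ≈⟨ toℚᵘ-toℚ (p * q) ⟩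
  mkℚᵘ (p * q) 0                          ≈⟨ *≡* (denominators-one p q) ⟩
  mkℚᵘ p 0 ℚᵘ.* mkℚᵘ q 0                  ≈⟨ ℚᵘP.*-cong (toℚᵘ-toℚ p) (toℚᵘ-toℚ q) ⟨
  ℚ.toℚᵘ (toℚ p) ℚᵘ.* ℚ.toℚᵘ (toℚ q)      ≈⟨ ℚP.toℚᵘ-homo-* (toℚ p) (toℚ q) ⟨
  ℚ.toℚᵘ (toℚ p ℚ.* toℚ q)                ∎)
  where
  open ℚᵘP.≃-Reasoning
  denominators-one : ∀ p q → p * q * (1ℤ * 1ℤ) ≡ p * q * 1ℤ
  denominators-one = solve-∀

toℚ-sum : ∀ {k} (f : Vector ℤ k) → toℚ (sum f) ≡ ℚΣ.sum (toℚ ∘ f)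
toℚ-sum {zero}  f = refl
toℚ-sum {suc k} f = trans (toℚ-+ (f zero) (sum (f ∘ suc))) (cong (toℚ (f zero) ℚ.+_) (toℚ-sum (f ∘ suc)))

toℚ-pos : ∀ {z} → 0ℤ < z → 0ℚ ℚ.< toℚ z
toℚ-pos {+ zero}     (+<+ ())
toℚ-pos {ℤ.+[1+ n ]} _ = ℚP.positive⁻¹ _ {{ℚP.normalize-pos (suc n) 1}}

toℚ-nonNeg : ∀ n → ℚ.NonNegative (toℚ (+ n))
toℚ-nonNeg n = ℚP.normalize-nonNeg n 1

sumℚ-nonneg : ∀ {k} (f : Vector ℚ k) → (∀ i → 0ℚ ℚ.≤ f i) → 0ℚ ℚ.≤ ℚΣ.sum f
sumℚ-nonneg {zero}  f f≥0 = ℚP.≤-refl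
sumℚ-nonneg {suc k} f f≥0 = ℚP.+-mono-≤ (f≥0 zero) (sumℚ-nonneg (f ∘ suc) (f≥0 ∘ suc))

sumℚ-pos : ∀ {k} (f : Vector ℚ k) → (∀ i → 0ℚ ℚ.≤ f i) → ∀ j → 0ℚ ℚ.< f j → 0ℚ ℚ.< ℚΣ.sum f
sumℚ-pos f f≥0 zero    0<f₀ = ℚP.+-mono-<-≤ 0<f₀ (sumℚ-nonneg (f ∘ suc) (f≥0 ∘ suc))
sumℚ-pos f f≥0 (suc j) 0<fⱼ = ℚP.+-mono-≤-< (f≥0 zero) (sumℚ-pos (f ∘ suc) (f≥0 ∘ suc) j 0<fⱼ)

pairing : ∀ {m} → Vector ℚ m → Vector ℤ m → ℚ
pairing w v = ℚΣ.sum (λ e → w e ℚ.* toℚ (v e))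

pairing-combination : ∀ {t m} (w : Vector ℚ m) (c : Vector ℤ t) (a : Vector (Vector ℤ m) t) →
                      pairing w (combination c a) ≡ ℚΣ.sum (λ i → toℚ (c i) ℚ.* pairing w (a i))
pairing-combination {t} {m} w c a = begin
  ℚΣ.sum (λ e → w e ℚ.* toℚ (combination c a e))
    ≡⟨ ℚΣ.sum-cong-≗ {m} (λ e → cong (w e ℚ.*_)
         (trans (toℚ-sum (λ i → c i * a i e)) (ℚΣ.sum-cong-≗ {t} (λ i → toℚ-* (c i) (a i e))))) ⟩
  ℚΣ.sum (λ e → w e ℚ.* ℚΣ.sum (λ i → toℚ (c i) ℚ.* toℚ (a i e)))
    ≡⟨ ℚΣ.sum-cong-≗ (λ e → ℚΣ.*-distribˡ-sum (w e) (λ i → toℚ (c i) ℚ.* toℚ (a i e))) ⟩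
  ℚΣ.sum (λ e → ℚΣ.sum (λ i → w e ℚ.* (toℚ (c i) ℚ.* toℚ (a i e))))
    ≡⟨ ℚΣ.∑-comm (λ e i → w e ℚ.* (toℚ (c i) ℚ.* toℚ (a i e))) ⟩
  ℚΣ.sum (λ i → ℚΣ.sum (λ e → w e ℚ.* (toℚ (c i) ℚ.* toℚ (a i e))))
    ≡⟨ ℚΣ.sum-cong-≗ (λ i → ℚΣ.sum-cong-≗ (λ e → ℚ*.x∙yz≈y∙xz (w e) (toℚ (c i)) (toℚ (a i e)))) ⟩
  ℚΣ.sum (λ i → ℚΣ.sum (λ e → toℚ (c i) ℚ.* (w e ℚ.* toℚ (a i e))))
    ≡⟨ ℚΣ.sum-cong-≗ (λ i → ℚΣ.*-distribˡ-sum (toℚ (c i)) (λ e → w e ℚ.* toℚ (a i e))) ⟨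
  ℚΣ.sum (λ i → toℚ (c i) ℚ.* pairing w (a i)) ∎
  where open ≡-Reasoning

pairing-toℚ : ∀ {m} (u v : Vector ℤ m) → pairing (toℚ ∘ u) v ≡ toℚ (u · v)
pairing-toℚ u v = trans (ℚΣ.sum-cong-≗ (λ e → sym (toℚ-* (u e) (v e)))) (sym (toℚ-sum (λ e → u e * v e)))

separated⇒independent : ∀ {t m} {a : Vector (Vector ℤ m) t} (w : Vector ℚ m) →
                        (∀ i → 0ℚ ℚ.< pairing w (a i)) → ¬ NonnegDependency a
separated⇒independent {t} {m} {a} w sep (y , (i , yi≢0) , dep) = ℚP.<-irrefl (sym total≡0) 0<total
  where
  total : ℚ
  total = ℚΣ.sum (λ j → toℚ (+ y j) ℚ.* pairing w (a j))
  0<total : 0ℚ ℚ.< total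
  0<total = sumℚ-pos _ term≥0 i term>0
    where
    term≥0 : ∀ j → 0ℚ ℚ.≤ toℚ (+ y j) ℚ.* pairing w (a j)
    term≥0 j = ℚP.nonNegative⁻¹ _ {{ℚP.nonNeg*nonNeg⇒nonNeg (toℚ (+ y j)) {{toℚ-nonNeg (y j)}}
                                     (pairing w (a j)) {{ℚP.pos⇒nonNeg (pairing w (a j)) {{ℚ.positive (sep j)}}}}}}
    term>0 : 0ℚ ℚ.< toℚ (+ y i) ℚ.* pairing w (a i)
    term>0 = ℚP.positive⁻¹ _ {{ℚP.pos*pos⇒pos (toℚ (+ y i)) {{ℚ.positive (toℚ-pos {+ y i} (+<+ (ℕP.n≢0⇒n>0 yi≢0)))}}
                                              (pairing w (a i)) {{ℚ.positive (sep i)}}}}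
  total≡0 : total ≡ 0ℚ
  total≡0 = begin
    total                                      ≡⟨ pairing-combination w (+_ ∘ y) a ⟨
    pairing w (combination (+_ ∘ y) a)
      ≡⟨ ℚΣ.sum-cong-≗ {m} (λ e → trans (cong (λ z → w e ℚ.* toℚ z) (dep e)) (ℚP.*-zeroʳ (w e))) ⟩
    ℚΣ.sum {m} (λ _ → 0ℚ)                      ≡⟨ ℚΣ.sum-replicate-zero m ⟩
    0ℚ                                         ∎
    where open ≡-Reasoning

-- Cycles of a graph

sumℤ≡sum : ∀ {k} (f : Vector ℤ k) → sumℤ f ≡ sum f
sumℤ≡sum {zero}  f = refl
sumℤ≡sum {suc k} f = cong (_+_ (f zero)) (sumℤ≡sum (f ∘ suc))

sumℚ≡sum : ∀ {k} (f : Vector ℚ k) → sumℚ f ≡ ℚΣ.sum f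
sumℚ≡sum {zero}  f = refl
sumℚ≡sum {suc k} f = cong (f zero ℚ.+_) (sumℚ≡sum (f ∘ suc))

sumℤ-cong : ∀ {k} {f g : Vector ℤ k} → f ≗ g → sumℤ f ≡ sumℤ g
sumℤ-cong {f = f} {g} f≗g = trans (sumℤ≡sum f) (trans (sum-cong-≗ f≗g) (sym (sumℤ≡sum g)))

inner≡pairing : (G : Graph) (w : Vector ℚ (Graph.m G)) (C : OrientedCycle G) →
                inner G w C ≡ pairing w (vec G C)
inner≡pairing G w C = sumℚ≡sum (λ e → w e ℚ.* toℚ (vec G C e))

allFunctions : ∀ {A : Set} → List A → ∀ k → List (Vector A k)
allFunctions xs zero    = [ (λ ()) ]
allFunctions xs (suc k) = cartesianProductWith Vec._∷_ xs (allFunctions xs k)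

allFunctions-complete : ∀ {A : Set} {xs : List A} → (∀ x → x ∈ xs) → ∀ {k} (f : Vector A k) →
                        Any (_≗ f) (allFunctions xs k)
allFunctions-complete ∈xs {zero}  f = here (λ ())
allFunctions-complete ∈xs {suc k} f =
  AnyP.cartesianProductWith⁺ Vec._∷_ cons-≗ (∈xs (f zero)) (allFunctions-complete ∈xs (tail f))
  where
  cons-≗ : ∀ {x g} → f zero ≡ x → g ≗ tail f → (x Vec.∷ g) ≗ f
  cons-≗ f₀≡x g≗ zero    = sym f₀≡x
  cons-≗ f₀≡x g≗ (suc i) = g≗ i


module _ (G : Graph) where
  open Graph G
  open OrientedCycle

  decSign : ∀ {P : Set} → Bool → Dec P → ℤ
  decSign b (yes _) = sign G b
  decSign b (no _)  = 0ℤ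

  dartCoeff : Fin m → Dart m → ℤ
  dartCoeff e (e′ , b) = decSign b (e′ ≟ e)

  private
    sum-by-decision : ∀ {e k} (_⊕_ : ℤ → ℤ → ℤ) (V : (e′ : Fin m) → Bool → Dec (e′ ≡ e) → ℤ) →
      (∀ e′ b p → V e′ b (yes p) ≡ sign G b) → (∀ e′ b ¬p → V e′ b (no ¬p) ≡ 0ℤ) →
      ∀ e′ b (d : Dec (e′ ≡ e)) (ds : Vector (Dart m) k) →
      V e′ b d ⊕ sumℤ (λ i → V (proj₁ (ds i)) (proj₂ (ds i)) (proj₁ (ds i) ≟ e))
        ≡ decSign b d ⊕ sumℤ (λ i → dartCoeff e (ds i))
    sum-by-decision {e} _⊕_ V V-yes V-no e′ b d ds =
      cong₂ _⊕_ (agree e′ b d) (sumℤ-cong (λ i → agree (proj₁ (ds i)) (proj₂ (ds i)) _))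
      where
      agree : ∀ e′ b (d : Dec (e′ ≡ e)) → V e′ b d ≡ decSign b d
      agree e′ b (yes p) = V-yes e′ b p
      agree e′ b (no ¬p) = V-no e′ b ¬p

  -- `vec` computes its summands by a local `with` on `e′ ≟ e` that cannot be named here. Abstracting
  -- the first dart, its decision and `_+_` exposes that local function applied to variables, so Agda
  -- infers it as `V` in `sum-by-decision`; the remaining summands then agree by evaluation.
  vec-coeff : (C : OrientedCycle G) (e : Fin m) → vec G C e ≡ sumℤ (λ i → dartCoeff e (darts C i))
  vec-coeff C e with darts C zero
  ... | e′ , b with e′ ≟ e | _+_
  ...   | d | _⊕_ = sum-by-decision _⊕_ _ (λ _ _ _ → refl) (λ _ _ _ → refl) e′ b d (λ i → darts C (suc i))

  IsCycle : (l : ℕ) → Vector (Dart m) (suc l) → Set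
  IsCycle l ds = (∀ (i : Fin l) → hd G (ds (inject₁ i)) ≡ tl G (ds (suc i)))
               × hd G (ds (fromℕ l)) ≡ tl G (ds zero)
               × (∀ i j → tl G (ds i) ≡ tl G (ds j) → i ≡ j)
               × (∀ i j → proj₁ (ds i) ≡ proj₁ (ds j) → i ≡ j)

  isCycle? : ∀ l ds → Dec (IsCycle l ds)
  isCycle? l ds = FinP.all? (λ i → hd G (ds (inject₁ i)) ≟ tl G (ds (suc i)))
           ×-dec hd G (ds (fromℕ l)) ≟ tl G (ds zero)
           ×-dec FinP.all? (λ i → FinP.all? (λ j → tl G (ds i) ≟ tl G (ds j) →-dec i ≟ j))
           ×-dec FinP.all? (λ i → FinP.all? (λ j → proj₁ (ds i) ≟ proj₁ (ds j) →-dec i ≟ j))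

  isCycle : (C : OrientedCycle G) → IsCycle (len C) (darts C)
  isCycle C = step C , close C , vertInj C , edgeInj C

  IsCycle-resp : ∀ {l ds ds′} → ds ≗ ds′ → IsCycle l ds → IsCycle l ds′
  IsCycle-resp {l} eq (step , close , vertInj , edgeInj) =
      (λ i → subst₂ (λ x y → hd G x ≡ tl G y) (eq (inject₁ i)) (eq (suc i)) (step i))
    , subst₂ (λ x y → hd G x ≡ tl G y) (eq (fromℕ l)) (eq zero) close
    , (λ i j → vertInj i j ∘ subst₂ (λ x y → tl G x ≡ tl G y) (sym (eq i)) (sym (eq j)))
    , (λ i j → edgeInj i j ∘ subst₂ (λ x y → proj₁ x ≡ proj₁ y) (sym (eq i)) (sym (eq j)))

  toCycle : ∀ {l} ds → IsCycle l ds → OrientedCycle G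
  toCycle {l} ds (step , close , vertInj , edgeInj) = record
    { len = l ; darts = ds ; step = step ; close = close ; vertInj = vertInj ; edgeInj = edgeInj }

  vec-toCycle : (C : OrientedCycle G) {ds : Vector (Dart m) (suc (len C))} (p : IsCycle (len C) ds) →
                ds ≗ darts C → vec G (toCycle ds p) ≗ vec G C
  vec-toCycle C {ds} p eq e = trans (vec-coeff (toCycle ds p) e) (trans (sumℤ-cong (cong (dartCoeff e) ∘ eq)) (sym (vec-coeff C e)))

  private
    cycleOn : ∀ l → Vector (Dart m) (suc l) → Maybe (OrientedCycle G)
    cycleOn l ds with isCycle? l ds
    ... | yes p = just (toCycle ds p)
    ... | no  _ = nothing

    cycleOn-complete : (C : OrientedCycle G) {ds : Vector (Dart m) (suc (len C))} → ds ≗ darts C →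
                       MAny.Any (λ D → vec G D ≗ vec G C) (cycleOn (len C) ds)
    cycleOn-complete C {ds} ds≗ with isCycle? (len C) ds
    ... | yes p = MAny.just (vec-toCycle C p ds≗)
    ... | no ¬p = contradiction (IsCycle-resp (sym ∘ ds≗) (isCycle C)) ¬p

  allDarts : List (Dart m)
  allDarts = cartesianProduct (allFin m) (true ∷ false ∷ [])

  ∈-allDarts : ∀ d → d ∈ allDarts
  ∈-allDarts (e , b) = ∈-cartesianProduct⁺ (∈-allFin e) (∈-bools b)
    where
    ∈-bools : ∀ b → b ∈ true ∷ false ∷ []
    ∈-bools true  = here refl
    ∈-bools false = there (here refl)

  allCycles : List (OrientedCycle G)
  allCycles = concatMap (λ l → mapMaybe (cycleOn l) (allFunctions allDarts (suc l))) (upTo m)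

  allCycles-complete : (C : OrientedCycle G) → Any (λ D → vec G D ≗ vec G C) allCycles
  allCycles-complete C = AnyP.concatMap⁺ _ (Any.map (λ { refl → cycles-of-length-C }) (∈-upTo⁺ len<m))
    where
    len<m : len C ℕ.< m
    len<m = FinP.injective⇒≤ (λ {i} {j} → edgeInj C i j)
    cycles-of-length-C : Any (λ D → vec G D ≗ vec G C) (mapMaybe (cycleOn (len C)) (allFunctions allDarts (suc (len C))))
    cycles-of-length-C = AnyP.mapMaybe⁺ (cycleOn (len C)) _
      (AnyP.map⁺ (Any.map (cycleOn-complete C) (allFunctions-complete ∈-allDarts (darts C))))

module _ (G : Graph) (κ : Configuration G) where
  open Graph G
  open Configuration κ

  private
    chosen? : ∀ C → Dec (chosen C ≡ true)
    chosen? C = chosen C Bool.≟ true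

  chosenCycles : List (OrientedCycle G)
  chosenCycles = filter chosen? (allCycles G)

  chosenCycle : Fin (length chosenCycles) → OrientedCycle G
  chosenCycle = List.lookup chosenCycles

  chosenCycle-chosen : ∀ i → chosen (chosenCycle i) ≡ true
  chosenCycle-chosen i = All.lookup (AllP.all-filter chosen? (allCycles G)) (∈-lookup i)

  chosenCycle-complete : ∀ C → chosen C ≡ true → ∃ λ i → vec G (chosenCycle i) ≗ vec G C
  chosenCycle-complete C C-chosen = Any.index covered , AnyP.lookup-index covered
    where
    covered : Any (λ D → vec G D ≗ vec G C) chosenCycles
    covered with AnyP.filter⁺ chosen? (allCycles-complete G C)
    ... | inj₁ p       = p
    ... | inj₂ ¬chosen = contradiction (trans (sameVec D C (AnyP.lookup-result D-covers)) C-chosen) ¬chosen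
      where
      D-covers : Any (λ D → vec G D ≗ vec G C) (allCycles G)
      D-covers = allCycles-complete G C
      D : OrientedCycle G
      D = Any.lookup D-covers

  geometric⇒onlyTrivial : Geometric G κ → OnlyTrivialSolution G κ
  geometric⇒onlyTrivial (w , _ , w-positive) k C C-chosen n n-dependency i with n i ℕ.≟ 0
  ... | yes nᵢ≡0 = nᵢ≡0
  ... | no  nᵢ≢0 = ⊥-elim (separated⇒independent w separated (n , (i , nᵢ≢0) , dependency))
    where
    separated : ∀ j → 0ℚ ℚ.< pairing w (vec G (C j))
    separated j = subst (0ℚ ℚ.<_) (inner≡pairing G w (C j)) (w-positive (C j) (C-chosen j))
    dependency : ∀ e → combination (+_ ∘ n) (vec G ∘ C) e ≡ 0ℤ
    dependency e = trans (sym (sumℤ≡sum (λ j → + n j * vec G (C j) e))) (n-dependency e)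

  private
    a : Vector (Vector ℤ m) (length chosenCycles)
    a = vec G ∘ chosenCycle

  trivial⇒independent : OnlyTrivialSolution G κ → ¬ NonnegDependency a
  trivial⇒independent trivial (y , (i , yᵢ≢0) , dep) =
    yᵢ≢0 (trivial _ chosenCycle chosenCycle-chosen y (λ e → trans (sumℤ≡sum (λ j → + y j * a j e)) (dep e)) i)

  geometric-of-separation : ∀ c → Separates a (combination c a) → Geometric G κ
  geometric-of-separation c separated = toℚ ∘ W , (_ , chosenCycle , toℚ ∘ c , W∈H₁) , W-positive
    where
    W : Vector ℤ m
    W = combination c a
    W∈H₁ : ∀ e → toℚ (W e) ≡ sumℚ (λ j → toℚ (c j) ℚ.* toℚ (a j e))
    W∈H₁ e = trans (toℚ-sum (λ j → c j * a j e))
                   (trans (ℚΣ.sum-cong-≗ (λ j → toℚ-* (c j) (a j e)))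
                          (sym (sumℚ≡sum (λ j → toℚ (c j) ℚ.* toℚ (a j e)))))
    W-positive : ∀ C → chosen C ≡ true → 0ℚ ℚ.< inner G (toℚ ∘ W) C
    W-positive C C-chosen = subst (0ℚ ℚ.<_) (sym inner≡) (toℚ-pos (subst (0ℤ <_) (·-comm (a i) W) (separated i)))
      where
      i : Fin (length chosenCycles)
      i = proj₁ (chosenCycle-complete C C-chosen)
      aᵢ≗vec : a i ≗ vec G C
      aᵢ≗vec = proj₂ (chosenCycle-complete C C-chosen)
      inner≡ : inner G (toℚ ∘ W) C ≡ toℚ (W · a i)
      inner≡ = trans (inner≡pairing G (toℚ ∘ W) C)
                     (trans (pairing-toℚ W (vec G C)) (cong toℚ (sum-cong-≗ (λ e → cong (W e *_) (sym (aᵢ≗vec e))))))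

  onlyTrivial⇒geometric : OnlyTrivialSolution G κ → Geometric G κ
  onlyTrivial⇒geometric trivial = [ uncurry geometric-of-separation , ⊥-elim ∘ trivial⇒independent trivial ]′ (gordan-span a)

theorem3p6 : (G : Graph) (κ : Configuration G) →
    Geometric G κ ⇔ OnlyTrivialSolution G κ
theorem3p6 G κ = mk⇔ (geometric⇒onlyTrivial G κ) (onlyTrivial⇒geometric G κ)
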